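{- Let $n\geq 3$ and $r\geq 2$ be integers, let $q$ be a positive integer with $2^{q+16r-1}\geq 10(n+1)(q+16r+1)r$, and set $s=q+16r+1$. Let $G$ be an odd carousel of order $s$ on $n$ sets $X_1,\dots,X_n$ and let $(Y,Z)$ be a partition of $V(G)$ with $\mathrm{rk}_G(Y,Z)<r$. Then there exists $t\in\{q,\dots,q+16r-1\}$ such that $X_{1,t}\cup X_{1,t+1}\subseteq Z$ or $X_{1,t}\cup X_{1,t+1}\subseteq Y$.
   Context: All graphs are finite and simple. Let $X=\{u^1,\dots,u^k\}$ and $X'=\{v^1,\dots,v^k\}$ be two disjoint ordered sets of $k$ vertices of a graph $G$. The triple $(G,X,X')$ is called: - a regular matching if for all $j,j'\in\{1,\dots,k\}$: $u^jv^{j'}\in E(G)$ iff $j=j'$; - a regular antimatching if: $u^jv^{j'}\in E(G)$ iff $j\neq j'$; - a regular crossing if: $u^jv^{j'}\in E(G)$ iff $j+j'\geq k+1$; - (when $k\equiv 2 \pmod 4$) a skew expanding matching if, for all $j'$: for $1\le j\le (k-2)/4$, $u^jv^{j'}\in E(G)$ iff $j'\in\{2j,2j+1\}$; for $(k-2)/4< j\le (3k+2)/4$, $u^jv^{j'}\notin E(G)$; for $(3k+2)/4<j\le k$, $u^jv^{j'}\in E(G)$ iff $j'\in\{2j-k-2,2j-k-1\}$; - (when $k\equiv 2\pmod 4$) a skew expanding antimatching: as the skew expanding matching except that for $(k-2)/4< j\le (3k+2)/4$, $u^jv^{j'}\in E(G)$ for all $j'$; - (when $k\equiv 2\pmod 4$)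 a skew expanding crossing if, for all $j'$: for $1\le j\le (k-2)/4$, $u^jv^{j'}\in E(G)$ iff $2j+j'\geq k$; for $(k-2)/4<j\le k/2$, iff $j'\geq k/2+1$; for $k/2<j\le (3k+2)/4$, iff $j'\geq k/2-1$; for $(3k+2)/4<j\le k$, iff $2j+j'-2\geq 2k$. Regular (resp. skew expanding) triples are those of the three regular (resp. skew expanding) kinds; crossings are cross triples, matchings and antimatchings are parallel triples. An odd carousel of order $s$ on $n\geq 3$ sets is a graph $G$ with $V(G)=X_1\cup\dots\cup X_n$ (disjoint), each $X_i=\{x_i^1,\dots,x_i^k\}$ ordered with $k=2(2^s-1)$, such that $(G,X_1,X_2)$ is a regular crossing, $(G,X_i,X_{i+1})$ is a regular triple for $2\le i\le n-1$, $(G,X_n,X_1)$ is a skew expanding triple, and the number of cross triples among $(G,X_i,X_{i+1})$, $i=1,\dots,n$ (indices mod $n$) is odd; all other edges are arbitrary. For disjoint $Y,Z\subseteq V(G)$, $\mathrm{rk}_G(Y,Z)$ is the $\mathrm{GF}(2)$-rank of the 0-1 adjacency matrix with rows $Y$ and columns $Z$. For $j\in\{1,\dots,s\}$, $X_{1,j}=\{x_1^{2^{j-1}},\dots,x_1^{2^j-1}\}$. -}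

module Defs where

open import Data.Bool using (Bool; true; false; not; _∧_; _∨_; _xor_; if_then_else_)
open import Data.Nat using (ℕ; zero; suc; _+_; _*_; _∸_; _^_; _≤_; _<_; _≤ᵇ_; _≡ᵇ_)
open import Data.Nat.DivMod using (_/_; _%_; _mod_)
open import Data.Fin using (Fin; toℕ)
import Data.Fin as Fin
open import Data.List using (List; foldr; map; cartesianProduct; allFin)
open import Data.Product using (Σ; _×_; _,_; ∃)
open import Data.Sum using (_⊎_)
open import Relation.Binary.PropositionalEquality using (_≡_)
open import Relation.Nullary using (¬_)

-- Vertex set X_1 ∪ … ∪ X_n with |X_i| = k.
-- The vertex (i , a) is x_{i+1}^{a+1}  (Agda indices are 0-based,
-- the paper's are 1-based).

Vtx : ℕ → ℕ → Set
Vtx n k = Fin n × Fin k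

allVtx : (n k : ℕ) → List (Vtx n k)
allVtx n k = cartesianProduct (allFin n) (allFin k)

record SimpleGraph (V : Set) : Set where
  field
    adj   : V → V → Bool
    sym   : ∀ u v → adj u v ≡ adj v u
    irrefl : ∀ v → adj v v ≡ false
open SimpleGraph public

kOf : ℕ → ℕ
kOf s = 2 * (2 ^ s ∸ 1)

-- The six kinds of triples, as Bool-valued "u^j v^j' is an edge" tables,
-- for 1-based indices j, j' ∈ {1..k}.

regMatching : ℕ → ℕ → ℕ → Bool
regMatching k j j' = j ≡ᵇ j'

regAntimatching : ℕ → ℕ → ℕ → Bool
regAntimatching k j j' = not (j ≡ᵇ j')

regCrossing : ℕ → ℕ → ℕ → Bool
regCrossing k j j' = (k + 1) ≤ᵇ (j + j')

lowRow : ℕ → ℕ → Bool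
lowRow k j = j ≤ᵇ ((k ∸ 2) / 4)

highRow : ℕ → ℕ → Bool
highRow k j = not (j ≤ᵇ ((3 * k + 2) / 4))

skewMatching : ℕ → ℕ → ℕ → Bool
skewMatching k j j' =
  if lowRow k j then ((j' ≡ᵇ 2 * j) ∨ (j' ≡ᵇ 2 * j + 1))
  else if highRow k j then ((j' ≡ᵇ 2 * j ∸ k ∸ 2) ∨ (j' ≡ᵇ 2 * j ∸ k ∸ 1))
  else false

skewAntimatching : ℕ → ℕ → ℕ → Bool
skewAntimatching k j j' =
  if lowRow k j then ((j' ≡ᵇ 2 * j) ∨ (j' ≡ᵇ 2 * j + 1))
  else if highRow k j then ((j' ≡ᵇ 2 * j ∸ k ∸ 2) ∨ (j' ≡ᵇ 2 * j ∸ k ∸ 1))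
  else true

skewCrossing : ℕ → ℕ → ℕ → Bool
skewCrossing k j j' =
  if lowRow k j then (k ≤ᵇ 2 * j + j')
  else if j ≤ᵇ (k / 2) then ((k / 2 + 1) ≤ᵇ j')
  else if not (highRow k j) then ((k / 2 ∸ 1) ≤ᵇ j')
  else ((2 * k) ≤ᵇ (2 * j + j' ∸ 2))

data Kind : Set where
  matching antimatching crossing : Kind

regularTable : Kind → ℕ → ℕ → ℕ → Bool
regularTable matching     = regMatching
regularTable antimatching = regAntimatching
regularTable crossing     = regCrossing

skewTable : Kind → ℕ → ℕ → ℕ → Bool
skewTable matching     = skewMatching
skewTable antimatching = skewAntimatching
skewTable crossing     = skewCrossing

Realises : {V : Set} (k : ℕ) → SimpleGraph V → (Fin k → V) → (Fin k → V)
         → (ℕ → ℕ → ℕ → Bool) → Set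
Realises k G X X' T =
  ∀ (a b : Fin k) → adj G (X a) (X' b) ≡ T k (suc (toℕ a)) (suc (toℕ b))

part : {n k : ℕ} → Fin n → Fin k → Vtx n k
part i a = (i , a)

nextIdx : {n : ℕ} → Fin n → Fin n
nextIdx {suc m} i = suc (toℕ i) mod (suc m)

countKind : (n : ℕ) → (Fin n → Kind) → ℕ
countKind zero    κ = 0
countKind (suc n) κ = isCross (κ Fin.zero) + countKind n (λ i → κ (Fin.suc i))
  where
  isCross : Kind → ℕ
  isCross crossing = 1
  isCross _        = 0

Odd : ℕ → Set
Odd m = m % 2 ≡ 1

-- G (on vertex set X_1 ∪ … ∪ X_n) is an odd carousel of order s:
-- κ i is the kind of the triple (G, X_{i+1}, X_{i+2}) (0-based i, mod n).
OddCarousel : (n s : ℕ) → SimpleGraph (Vtx n (kOf s)) → Set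
OddCarousel n s G =
  3 ≤ n ×
  Σ (Fin n → Kind) λ κ →
    (∀ i → toℕ i ≡ 0 → κ i ≡ crossing) ×
    (∀ i → suc (toℕ i) < n →
       Realises (kOf s) G (part i) (part (nextIdx i)) (regularTable (κ i))) ×
    (∀ i → suc (toℕ i) ≡ n →
       Realises (kOf s) G (part i) (part (nextIdx i)) (skewTable (κ i))) ×
    Odd (countKind n κ)

-- GF(2)-rank of the bipartite adjacency matrix between Y and Z.
-- Subsets of V are Bool predicates; Bool is GF(2) (xor = +, ∧ = ·).

module _ {V : Set} (allV : List V) where

  xorSum : (V → Bool) → Bool
  xorSum f = foldr (λ v b → f v xor b) false allV

  card : (V → Bool) → ℕ
  card S = foldr (λ v m → (if S v then 1 else 0) + m) 0 allV

  _⊆_ : (V → Bool) → (V → Bool) → Set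
  S ⊆ T = ∀ v → S v ≡ true → T v ≡ true

  -- the rows of the (Y × Z) matrix indexed by S ⊆ Y are linearly
  -- independent over GF(2): every nontrivial GF(2)-combination (given by a
  -- nonempty coefficient set T ⊆ S) has a nonzero entry in some column z ∈ Z.
  IndepRows : (V → V → Bool) → (Z S : V → Bool) → Set
  IndepRows A Z S =
    ∀ (T : V → Bool) → T ⊆ S → (∃ λ v → T v ≡ true) →
      ∃ λ z → Z z ≡ true × xorSum (λ v → T v ∧ A v z) ≡ true

  HasRank : (V → V → Bool) → (Y Z : V → Bool) → ℕ → Set
  HasRank A Y Z m =
    (Σ (V → Bool) λ S → S ⊆ Y × IndepRows A Z S × card S ≡ m) ×
    (∀ S → S ⊆ Y → IndepRows A Z S → card S ≤ m)

-- X_{1,j} = {x_1^{2^{j-1}}, …, x_1^{2^j − 1}} : membership of x_1^p (1-based p)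

InX1 : ℕ → ℕ → Set
InX1 j p = 2 ^ (j ∸ 1) ≤ p × p ≤ 2 ^ j ∸ 1

X1UnionIn : {n k : ℕ} → (Vtx n k → Bool) → ℕ → Bool → Set
X1UnionIn {n} {k} side t b =
  ∀ (i : Fin n) (a : Fin k) → toℕ i ≡ 0 →
    (InX1 t (suc (toℕ a)) ⊎ InX1 (t + 1) (suc (toℕ a))) → side (i , a) ≡ b

{-# OPTIONS --safe #-}
-- Read X₂ in reverse order, so that x₁ʸ is adjacent to the x-th
-- vertex from the end of X₂ exactly when x ≤ y. If none of the 2r blocks X₁,t ∪ X₁,t+1 with
-- t = q, q+2, … were monochromatic, each would contain positions x ≤ y with x₁ʸ on the other
-- side of the partition from the reversed x₂ˣ. Since the blocks are separated, these 2r pairs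
-- form a ladder: the X₁-vertex of pair i is adjacent to the X₂-vertex of pair j iff i ≥ j.
-- At least r pairs put their X₂-vertex on the same side, and the corresponding r × r submatrix
-- of the Y × Z adjacency matrix is triangular with unit diagonal, so rk(Y, Z) ≥ r.
module Submission where

open import Defs hiding (sym)
open import Data.Bool using (Bool; true; false; not; _∧_; _∨_; if_then_else_)
open import Data.Bool.Properties using (not-involutive; ¬-not) renaming (_≟_ to _≟𝔹_)
open import Data.Empty using (⊥; ⊥-elim)
open import Data.Fin using (Fin; toℕ; opposite)
  renaming (zero to fzero; suc to fsuc; _<_ to _<ᶠ_)
open import Data.Fin.Properties using (any?; toℕ<n; opposite-prop)
  renaming (_≟_ to _≟ᶠ_; suc-injective to fsuc-injective; <-cmp to <ᶠ-cmp; <-trans to <ᶠ-trans)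
open import Data.List using (List; []; _∷_)
open import Data.List.Membership.Propositional using (_∈_; _∉_)
open import Data.List.Membership.Propositional.Properties using (∈-cartesianProduct⁺; ∈-allFin)
open import Data.List.Relation.Unary.All.Properties using (All¬⇒¬Any)
open import Data.List.Relation.Unary.AllPairs using (_∷_)
open import Data.List.Relation.Unary.Any using (here; there)
open import Data.List.Relation.Unary.Unique.Propositional using (Unique)
open import Data.List.Relation.Unary.Unique.Propositional.Properties using (cartesianProduct⁺; allFin⁺)
open import Data.Nat using (ℕ; zero; suc; _+_; _*_; _∸_; _^_; _≤_; _<_; _≤ᵇ_; s≤s; s≤s⁻¹; _≤?_)
open import Data.Nat.Properties
  using ( +-suc; +-comm; +-identityʳ; m+[n∸m]≡n; m≤m+n; n<1+n; m^n>0; ^-monoʳ-≤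
        ; ≤-refl; ≤-trans; ≤-<-trans; ≤-total; <⇒≤; <⇒≱; +-cancelʳ-≤
        ; +-mono-≤; +-monoˡ-≤; +-monoʳ-≤; +-mono-<; +-monoʳ-<; *-monoʳ-≤; *-monoˡ-≤; *-monoʳ-<
        ; module ≤-Reasoning )
open import Data.Nat.Tactic.RingSolver using (solve-∀)
open import Data.Product using (Σ; ∃; _×_; _,_)
open import Data.Product.Properties using (≡-dec)
open import Data.Sum using (_⊎_; inj₁; inj₂)
open import Function.Bundles using (mk⇔)
open import Relation.Binary.Definitions using (DecidableEquality; tri<; tri≈; tri>)
open import Relation.Binary.PropositionalEquality
  using (_≡_; _≢_; refl; sym; trans; cong; cong₂; subst; module ≡-Reasoning)
open import Relation.Nullary using (Dec; yes; no; does)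
open import Relation.Nullary.Decidable using (does-⇔; dec-true; dec-false; _×-dec_; _⊎-dec_)

false≢true : false ≢ true
false≢true ()

∧-elim : ∀ {a b} → a ∧ b ≡ true → a ≡ true × b ≡ true
∧-elim {true} {true} _ = refl , refl

∧-intro : ∀ {a b} → a ≡ true → b ≡ true → a ∧ b ≡ true
∧-intro refl refl = refl

isOdd : ℕ → Bool
isOdd zero    = false
isOdd (suc n) = not (isOdd n)

module Card {V : Set} (_≟_ : DecidableEquality V) where

  _≟ᵇ_ : V → V → Bool
  u ≟ᵇ v = does (u ≟ v)

  ≟ᵇ⇒≡ : ∀ {u v} → u ≟ᵇ v ≡ true → u ≡ v
  ≟ᵇ⇒≡ {u} {v} eq with u ≟ v | eq
  ... | yes u≡v | _ = u≡v
  ... | no _    | ()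

  card-cong : ∀ L {f g : V → Bool} → (∀ v → f v ≡ g v) → card L f ≡ card L g
  card-cong []      f≗g = refl
  card-cong (v ∷ L) f≗g = cong₂ _+_ (cong (λ b → if b then 1 else 0) (f≗g v)) (card-cong L f≗g)

  card-false : (L : List V) → card L (λ _ → false) ≡ 0
  card-false []      = refl
  card-false (v ∷ L) = card-false L

  card-∨-disjoint : ∀ L (f g : V → Bool) → (∀ v → f v ≡ true → g v ≡ true → ⊥) →
                    card L (λ v → f v ∨ g v) ≡ card L f + card L g
  card-∨-disjoint []      f g disjoint = refl
  card-∨-disjoint (v ∷ L) f g disjoint with f v in fv | g v in gv
  ... | true  | true  = ⊥-elim (disjoint v fv gv)
  ... | true  | false = cong suc (card-∨-disjoint L f g disjoint)
  ... | false | true  = trans (cong suc (card-∨-disjoint L f g disjoint)) (sym (+-suc _ _))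
  ... | false | false = card-∨-disjoint L f g disjoint

  card-≟ᵇ-∉ : ∀ {w} L → w ∉ L → card L (w ≟ᵇ_) ≡ 0
  card-≟ᵇ-∉ {w} []      w∉L = refl
  card-≟ᵇ-∉ {w} (v ∷ L) w∉L with w ≟ v
  ... | yes w≡v = ⊥-elim (w∉L (here w≡v))
  ... | no _    = card-≟ᵇ-∉ L (λ w∈L → w∉L (there w∈L))

  card-≟ᵇ : ∀ {w} L → Unique L → w ∈ L → card L (w ≟ᵇ_) ≡ 1
  card-≟ᵇ {w} (v ∷ L) (v∉L ∷ _) (here refl) with w ≟ w
  ... | yes _  = cong suc (card-≟ᵇ-∉ L (All¬⇒¬Any v∉L))
  ... | no w≢w = ⊥-elim (w≢w refl)
  card-≟ᵇ {w} (v ∷ L) (v∉L ∷ unique) (there w∈L) with w ≟ v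
  ... | yes refl = ⊥-elim (All¬⇒¬Any v∉L w∈L)
  ... | no _     = card-≟ᵇ L unique w∈L

  xorSum≡isOdd-card : ∀ L (f : V → Bool) → xorSum L f ≡ isOdd (card L f)
  xorSum≡isOdd-card []      f = refl
  xorSum≡isOdd-card (v ∷ L) f with f v
  ... | true  = cong not (xorSum≡isOdd-card L f)
  ... | false = xorSum≡isOdd-card L f

countFin : ∀ {N} → (Fin N → Bool) → ℕ
countFin {zero}  f = 0
countFin {suc N} f = (if f fzero then 1 else 0) + countFin (λ i → f (fsuc i))

anyFin : ∀ {N} → (Fin N → Bool) → Bool
anyFin {zero}  f = false
anyFin {suc N} f = f fzero ∨ anyFin (λ i → f (fsuc i))

anyFin-witness : ∀ {N} (f : Fin N → Bool) → anyFin f ≡ true → ∃ λ i → f i ≡ true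
anyFin-witness {suc N} f any-f with f fzero in f0
... | true  = fzero , f0
... | false with anyFin-witness (λ i → f (fsuc i)) any-f
...   | i , fi = fsuc i , fi

countFin-complement : ∀ {N} (f : Fin N → Bool) → countFin f + countFin (λ i → not (f i)) ≡ N
countFin-complement {zero}  f = refl
countFin-complement {suc N} f with f fzero
... | true  = cong suc (countFin-complement (λ i → f (fsuc i)))
... | false = trans (+-suc _ _) (cong suc (countFin-complement (λ i → f (fsuc i))))

maximal : ∀ {N} (_≺_ : Fin N → Fin N → Set) →
  (∀ {i j l} → i ≺ j → j ≺ l → i ≺ l) → (∀ i j → i ≢ j → i ≺ j ⊎ j ≺ i) →
  (P : Fin N → Bool) → ∀ {i} → P i ≡ true →
  Σ (Fin N) λ e → P e ≡ true × (∀ j → P j ≡ true → j ≢ e → j ≺ e)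
maximal {suc N} _≺_ ≺-trans ≺-connex P {i} Pi
  with any? (λ j → P (fsuc j) ≟𝔹 true)
... | no none = fzero , holds-at-zero i Pi
                , λ { fzero _ 0≢0 → ⊥-elim (0≢0 refl) ; (fsuc j) Pj _ → ⊥-elim (none (j , Pj)) }
  where
  holds-at-zero : ∀ a → P a ≡ true → P fzero ≡ true
  holds-at-zero fzero    Pa = Pa
  holds-at-zero (fsuc j) Pa = ⊥-elim (none (j , Pa))
... | yes (j , Pj) with maximal (λ a b → fsuc a ≺ fsuc b) ≺-trans
                        (λ a b a≢b → ≺-connex (fsuc a) (fsuc b) (λ eq → a≢b (fsuc-injective eq)))
                        (λ a → P (fsuc a)) Pj
... | e , Pe , e-max with P fzero in P0
...   | false = fsuc e , Pe , λ { fzero P0′ _ → ⊥-elim (false≢true (trans (sym P0) P0′))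
                                ; (fsuc j) Pj j≢e → e-max j Pj (λ eq → j≢e (cong fsuc eq)) }
...   | true with ≺-connex fzero (fsuc e) (λ ())
...     | inj₁ 0≺e = fsuc e , Pe , λ { fzero _ _ → 0≺e
                                     ; (fsuc j) Pj j≢e → e-max j Pj (λ eq → j≢e (cong fsuc eq)) }
...     | inj₂ e≺0 = fzero , P0 , λ { fzero _ 0≢0 → ⊥-elim (0≢0 refl) ; (fsuc j) Pj _ → below-0 j Pj }
  where
  below-0 : ∀ j → P (fsuc j) ≡ true → fsuc j ≺ fzero
  below-0 j Pj with j ≟ᶠ e
  ... | yes refl = e≺0
  ... | no j≢e   = ≺-trans (e-max j Pj j≢e) e≺0

module Triangular {V : Set} (_≟_ : DecidableEquality V)
  (L : List V) (L-unique : Unique L) (L-complete : ∀ v → v ∈ L)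
  (A : V → V → Bool) (Y Z : V → Bool) where

  open Card _≟_

  rowSet : ∀ {N} → (Fin N → Bool) → (Fin N → V) → V → Bool
  rowSet sel row v = anyFin (λ i → sel i ∧ (row i ≟ᵇ v))

  rowSet-witness : ∀ {N} (sel : Fin N → Bool) (row : Fin N → V) {v} → rowSet sel row v ≡ true →
                   ∃ λ i → sel i ≡ true × row i ≡ v
  rowSet-witness sel row v∈ with anyFin-witness _ v∈
  ... | i , sel∧row with ∧-elim {sel i} sel∧row
  ...   | sel-i , row-i = i , sel-i , ≟ᵇ⇒≡ row-i

  card-rowSet : ∀ {N} (sel : Fin N → Bool) (row : Fin N → V) →
    (∀ i j → sel i ≡ true → sel j ≡ true → row i ≡ row j → i ≡ j) →
    card L (rowSet sel row) ≡ countFin sel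
  card-rowSet {zero}  sel row row-inj = card-false L
  card-rowSet {suc N} sel row row-inj =
    trans (card-∨-disjoint L _ _ disjoint)
          (cong₂ _+_ head (card-rowSet (λ i → sel (fsuc i)) (λ i → row (fsuc i))
             (λ i j si sj eq → fsuc-injective (row-inj (fsuc i) (fsuc j) si sj eq))))
    where
    head : card L (λ v → sel fzero ∧ (row fzero ≟ᵇ v)) ≡ (if sel fzero then 1 else 0)
    head with sel fzero
    ... | true  = card-≟ᵇ L L-unique (L-complete (row fzero))
    ... | false = card-false L
    disjoint : ∀ v → sel fzero ∧ (row fzero ≟ᵇ v) ≡ true →
               rowSet (λ i → sel (fsuc i)) (λ i → row (fsuc i)) v ≡ true → ⊥
    disjoint v first rest
      with ∧-elim {sel fzero} first | rowSet-witness (λ i → sel (fsuc i)) (λ i → row (fsuc i)) rest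
    ... | sel-0 , row-0 | i , sel-i , refl
      with row-inj fzero (fsuc i) sel-0 sel-i (≟ᵇ⇒≡ row-0)
    ... | ()

  module _ {N} (_≺_ : Fin N → Fin N → Set)
    (≺-trans : ∀ {i j l} → i ≺ j → j ≺ l → i ≺ l) (≺-connex : ∀ i j → i ≢ j → i ≺ j ⊎ j ≺ i)
    (sel : Fin N → Bool) (row col : Fin N → V)
    (diagonal : ∀ i → sel i ≡ true → A (row i) (col i) ≡ true)
    (triangular : ∀ i j → sel i ≡ true → sel j ≡ true → i ≺ j → A (row i) (col j) ≡ false)
    (row-in-Y : ∀ i → sel i ≡ true → Y (row i) ≡ true)
    (col-in-Z : ∀ i → sel i ≡ true → Z (col i) ≡ true)
    where

    row-injective : ∀ i j → sel i ≡ true → sel j ≡ true → row i ≡ row j → i ≡ j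
    row-injective i j sel-i sel-j row-i≡row-j with i ≟ᶠ j
    ... | yes i≡j = i≡j
    ... | no i≢j with ≺-connex i j i≢j
    ...   | inj₁ i≺j = ⊥-elim (false≢true (trans (sym (triangular i j sel-i sel-j i≺j))
                                          (trans (cong (λ v → A v (col j)) row-i≡row-j) (diagonal j sel-j))))
    ...   | inj₂ j≺i = ⊥-elim (false≢true (trans (sym (triangular j i sel-j sel-i j≺i))
                                          (trans (cong (λ v → A v (col i)) (sym row-i≡row-j)) (diagonal i sel-i))))

    -- In the column of the ≺-largest row of a combination, every other row of it vanishes.
    rowSet-independent : IndepRows L A Z (rowSet sel row)
    rowSet-independent T T⊆rows (v , Tv) with rowSet-witness sel row (T⊆rows v Tv)
    ... | i , sel-i , refl with maximal _≺_ ≺-trans ≺-connex (λ j → sel j ∧ T (row j)) (∧-intro sel-i Tv)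
    ... | e , sel∧T-e , e-max with ∧-elim {sel e} sel∧T-e
    ... | sel-e , T-e = col e , col-in-Z e sel-e , (begin
      xorSum L (λ w → T w ∧ A w (col e))       ≡⟨ xorSum≡isOdd-card L _ ⟩
      isOdd (card L (λ w → T w ∧ A w (col e))) ≡⟨ cong isOdd (card-cong L only-row-e) ⟩
      isOdd (card L (row e ≟ᵇ_))               ≡⟨ cong isOdd (card-≟ᵇ L L-unique (L-complete (row e))) ⟩
      true                                     ∎)
      where
      open ≡-Reasoning
      only-row-e : ∀ w → T w ∧ A w (col e) ≡ row e ≟ᵇ w
      only-row-e w with row e ≟ w
      ... | yes refl = cong₂ _∧_ T-e (diagonal e sel-e)
      ... | no row-e≢w with T w in Tw
      ...   | false = refl
      ...   | true with rowSet-witness sel row (T⊆rows w Tw)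
      ...     | j , sel-j , refl =
        triangular j e sel-j sel-e (e-max j (∧-intro sel-j Tw) (λ j≡e → row-e≢w (cong row (sym j≡e))))

    rowSet⊆Y : _⊆_ L (rowSet sel row) Y
    rowSet⊆Y v v∈ with rowSet-witness sel row v∈
    ... | i , sel-i , refl = row-in-Y i sel-i

    countFin≤rank : ∀ {m} → (∀ S → _⊆_ L S Y → IndepRows L A Z S → card L S ≤ m) → countFin sel ≤ m
    countFin≤rank rank-bound =
      subst (_≤ _) (card-rowSet sel row row-injective) (rank-bound _ rowSet⊆Y rowSet-independent)

module Crossing {V : Set} (G : SimpleGraph V) {k : ℕ} (X X′ : Fin k → V)
  (crossing : Realises k G X X′ regCrossing) where

  -- Reversing X′ turns the anti-diagonal threshold j + j′ ≥ k + 1 into the order y ≥ x.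
  adj-opposite : ∀ x y → adj G (X y) (X′ (opposite x)) ≡ (toℕ x ≤ᵇ toℕ y)
  adj-opposite x y = trans (crossing y (opposite x))
    (does-⇔ (mk⇔ to from) (k + 1 ≤? suc (toℕ y) + suc c) (toℕ x ≤? toℕ y))
    where
    c = toℕ (opposite x)
    k+1≡ : k + 1 ≡ suc (toℕ x) + suc c
    k+1≡ = trans (+-comm k 1) (cong suc (sym (begin
      toℕ x + suc c                   ≡⟨ cong (λ d → toℕ x + suc d) (opposite-prop x) ⟩
      toℕ x + suc (k ∸ suc (toℕ x))   ≡⟨ +-suc (toℕ x) _ ⟩
      suc (toℕ x) + (k ∸ suc (toℕ x)) ≡⟨ m+[n∸m]≡n (toℕ<n x) ⟩
      k                               ∎)))
      where open ≡-Reasoning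
    to : k + 1 ≤ suc (toℕ y) + suc c → toℕ x ≤ toℕ y
    to le = s≤s⁻¹ (+-cancelʳ-≤ (suc c) (suc (toℕ x)) (suc (toℕ y)) (subst (_≤ suc (toℕ y) + suc c) k+1≡ le))
    from : toℕ x ≤ toℕ y → k + 1 ≤ suc (toℕ y) + suc c
    from x≤y = subst (_≤ suc (toℕ y) + suc c) (sym k+1≡) (+-monoˡ-≤ (suc c) (s≤s x≤y))

InBlock : ℕ → ℕ → Set
InBlock t p = InX1 t p ⊎ InX1 (t + 1) p

InBlock? : ∀ t p → Dec (InBlock t p)
InBlock? t p = InX1? t p ⊎-dec InX1? (t + 1) p
  where
  InX1? : ∀ t p → Dec (InX1 t p)
  InX1? t p = (2 ^ (t ∸ 1) ≤? p) ×-dec (p ≤? 2 ^ t ∸ 1)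

<⇒≤∸1 : ∀ {s t} → s < t → s ≤ t ∸ 1
<⇒≤∸1 {t = suc t} (s≤s s≤t) = s≤t

∸1< : ∀ {n} → 0 < n → n ∸ 1 < n
∸1< {suc n} _ = n<1+n n

InX1-< : ∀ {s t p p′} → s < t → InX1 s p → InX1 t p′ → p < p′
InX1-< {s} {t} {p} {p′} s<t (_ , p≤) (≤p′ , _) = begin-strict
  p           ≤⟨ p≤ ⟩
  2 ^ s ∸ 1   <⟨ ∸1< (m^n>0 2 s) ⟩
  2 ^ s       ≤⟨ ^-monoʳ-≤ 2 (<⇒≤∸1 s<t) ⟩
  2 ^ (t ∸ 1) ≤⟨ ≤p′ ⟩
  p′          ∎
  where open ≤-Reasoning

InX1-<-InBlock : ∀ {s t p p′} → s < t → InX1 s p → InBlock t p′ → p < p′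
InX1-<-InBlock s<t p∈ (inj₁ p′∈) = InX1-< s<t p∈ p′∈
InX1-<-InBlock s<t p∈ (inj₂ p′∈) = InX1-< (≤-trans s<t (m≤m+n _ 1)) p∈ p′∈

InBlock-< : ∀ {t t′ p p′} → t + 1 < t′ → InBlock t p → InBlock t′ p′ → p < p′
InBlock-< t+1<t′ (inj₁ p∈) = InX1-<-InBlock (≤-<-trans (m≤m+n _ 1) t+1<t′) p∈
InBlock-< t+1<t′ (inj₂ p∈) = InX1-<-InBlock t+1<t′ p∈

Monochromatic : ∀ {k} → (Fin k → Set) → (Fin k → Bool) → Set
Monochromatic B c = Σ Bool λ b → ∀ a → B a → c a ≡ b

record Split {k} (B : Fin k → Set) (c c′ : Fin k → Bool) : Set where
  field
    lower upper   : Fin k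
    lower≤upper   : toℕ lower ≤ toℕ upper
    lower∈        : B lower
    upper∈        : B upper
    colours-split : c upper ≡ not (c′ lower)

module _ {k} {B : Fin k → Set} (B? : ∀ a → Dec (B a)) (c c′ : Fin k → Bool) where

  split-of-pair : ∀ {x y} → B x → B y → toℕ x ≤ toℕ y → c y ≡ not (c x) → Split B c c′
  split-of-pair {x} {y} x∈ y∈ x≤y cy with c x ≟𝔹 not (c′ x)
  ... | yes cx  = record { lower = x ; upper = x ; lower∈ = x∈ ; upper∈ = x∈ ; lower≤upper = ≤-refl
                        ; colours-split = cx }
  ... | no cx≢ = record { lower = x ; upper = y ; lower∈ = x∈ ; upper∈ = y∈ ; lower≤upper = x≤y
                        ; colours-split = trans cy (cong not (trans (¬-not cx≢) (not-involutive _))) }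

  monochromatic-or-split : Monochromatic B c ⊎ Split B c c′
  monochromatic-or-split
    with any? (λ a → B? a ×-dec (c a ≟𝔹 true)) | any? (λ a → B? a ×-dec (c a ≟𝔹 false))
  ... | no none-true | _ = inj₁ (false , λ a a∈ → ¬-not (λ ca → none-true (a , a∈ , ca)))
  ... | yes _ | no none-false = inj₁ (true , λ a a∈ → ¬-not (λ ca → none-false (a , a∈ , ca)))
  ... | yes (a₁ , a₁∈ , c₁) | yes (a₂ , a₂∈ , c₂) with ≤-total (toℕ a₁) (toℕ a₂)
  ...   | inj₁ a₁≤a₂ = inj₂ (split-of-pair a₁∈ a₂∈ a₁≤a₂ (trans c₂ (cong not (sym c₁))))
  ...   | inj₂ a₂≤a₁ = inj₂ (split-of-pair a₂∈ a₁∈ a₂≤a₁ (trans c₁ (cong not (sym c₂))))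

≢⇒<⊎> : ∀ {N} (i j : Fin N) → i ≢ j → i <ᶠ j ⊎ j <ᶠ i
≢⇒<⊎> i j i≢j with <ᶠ-cmp i j
... | tri< i<j _ _ = inj₁ i<j
... | tri≈ _ i≡j _ = ⊥-elim (i≢j i≡j)
... | tri> _ _ j<i = inj₂ j<i

module Ladder {V : Set} (_≟_ : DecidableEquality V)
  (L : List V) (L-unique : Unique L) (L-complete : ∀ v → v ∈ L)
  (G : SimpleGraph V) {k : ℕ} (X X′ : Fin k → V) (crossing : Realises k G X X′ regCrossing)
  (side : V → Bool) {m : ℕ}
  (rank-bound : ∀ S → _⊆_ L S side → IndepRows L (adj G) (λ v → not (side v)) S → card L S ≤ m)
  where

  open Crossing G X X′ crossing
  open Triangular _≟_ L L-unique L-complete (adj G) side (λ v → not (side v))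

  -- The rungs with their X′-end in Y and those with their X-end in Y each form a triangular family.
  ladder-length : ∀ {N} (x y : Fin N → Fin k) →
    (∀ i → toℕ (x i) ≤ toℕ (y i)) →
    (∀ i j → i <ᶠ j → toℕ (y i) < toℕ (x j)) →
    (∀ i → side (X (y i)) ≡ not (side (X′ (opposite (x i))))) →
    N ≤ m + m
  ladder-length {N} x y x≤y y<x rung-split =
    subst (_≤ m + m) (countFin-complement rung-in-Y) (+-mono-≤ X′-rows X-rows)
    where
    rung-in-Y : Fin N → Bool
    rung-in-Y i = side (X′ (opposite (x i)))

    rung-edge : ∀ i j → adj G (X (y j)) (X′ (opposite (x i))) ≡ (toℕ (x i) ≤ᵇ toℕ (y j))
    rung-edge i j = adj-opposite (x i) (y j)

    X-rows : countFin (λ i → not (rung-in-Y i)) ≤ m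
    X-rows = countFin≤rank _<ᶠ_ <ᶠ-trans ≢⇒<⊎> _ (λ i → X (y i)) (λ i → X′ (opposite (x i)))
      (λ i _ → trans (rung-edge i i) (dec-true (toℕ (x i) ≤? toℕ (y i)) (x≤y i)))
      (λ i j _ _ i<j → trans (rung-edge j i) (dec-false (toℕ (x j) ≤? toℕ (y i)) (<⇒≱ (y<x i j i<j))))
      (λ i in-Y → trans (rung-split i) in-Y)
      (λ i in-Y → in-Y)
      rank-bound

    X′-rows : countFin rung-in-Y ≤ m
    X′-rows = countFin≤rank (λ i j → j <ᶠ i) (λ i>j j>l → <ᶠ-trans j>l i>j)
      (λ i j i≢j → ≢⇒<⊎> j i (λ j≡i → i≢j (sym j≡i)))
      _ (λ i → X′ (opposite (x i))) (λ i → X (y i))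
      (λ i _ → trans (SimpleGraph.sym G _ _)
                 (trans (rung-edge i i) (dec-true (toℕ (x i) ≤? toℕ (y i)) (x≤y i))))
      (λ i j _ _ j<i → trans (SimpleGraph.sym G _ _)
                         (trans (rung-edge i j) (dec-false (toℕ (x i) ≤? toℕ (y j)) (<⇒≱ (y<x j i j<i)))))
      (λ i in-Y → in-Y)
      (λ i in-Y → trans (cong not (rung-split i)) (trans (not-involutive _) in-Y))
      rank-bound

some-or-all : ∀ {N} {P Q : Fin N → Set} → (∀ i → P i ⊎ Q i) → ∃ P ⊎ (∀ i → Q i)
some-or-all {zero}  p⊎q = inj₂ λ ()
some-or-all {suc N} p⊎q with p⊎q fzero | some-or-all (λ i → p⊎q (fsuc i))
... | inj₁ p | _            = inj₁ (fzero , p)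
... | inj₂ _ | inj₁ (i , p) = inj₁ (fsuc i , p)
... | inj₂ q | inj₂ qs      = inj₂ λ { fzero → q ; (fsuc i) → qs i }

_≟ⱽ_ : ∀ {n k} → DecidableEquality (Vtx n k)
_≟ⱽ_ = ≡-dec _≟ᶠ_ _≟ᶠ_

allVtx-unique : ∀ n k → Unique (allVtx n k)
allVtx-unique n k = cartesianProduct⁺ (allFin⁺ n) (allFin⁺ k)

allVtx-complete : ∀ {n k} (v : Vtx n k) → v ∈ allVtx n k
allVtx-complete (i , a) = ∈-cartesianProduct⁺ (∈-allFin i) (∈-allFin a)

X₁X₂-crossing : ∀ {n s} {G : SimpleGraph (Vtx (suc n) (kOf s))} → OddCarousel (suc n) s G →
  Realises (kOf s) G (part fzero) (part (nextIdx fzero)) regCrossing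
X₁X₂-crossing {s = s} {G} (3≤n , κ , κ₀ , regular , _) =
  subst (λ κ₁ → Realises (kOf s) G (part fzero) (part (nextIdx fzero)) (regularTable κ₁))
        (κ₀ fzero refl) (regular fzero (<⇒≤ 3≤n))

monochromatic⇒X1UnionIn : ∀ {n k} {side : Vtx (suc n) k → Bool} {t} →
  Monochromatic (λ a → InBlock t (suc (toℕ a))) (λ a → side (fzero , a)) →
  X1UnionIn side t false ⊎ X1UnionIn side t true
monochromatic⇒X1UnionIn (false , mono) = inj₁ λ { fzero a _ a∈ → mono a a∈ ; (fsuc _) _ () _ }
monochromatic⇒X1UnionIn (true  , mono) = inj₂ λ { fzero a _ a∈ → mono a a∈ ; (fsuc _) _ () _ }

block-gap : ∀ q {i j} → i < j → q + 2 * i + 1 < q + 2 * j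
block-gap q {i} {j} i<j = subst (_≤ q + 2 * j) (shift q i) (+-monoʳ-≤ q (*-monoʳ-≤ 2 i<j))
  where
  shift : ∀ q i → q + 2 * suc i ≡ suc (q + 2 * i + 1)
  shift = solve-∀

block-in-range : ∀ q r {i} → i < 2 * r → q + 2 * i ≤ q + 16 * r ∸ 1
block-in-range q r {i} i<2r = <⇒≤∸1 (+-monoʳ-< q (begin-strict
  2 * i       <⟨ *-monoʳ-< 2 i<2r ⟩
  2 * (2 * r) ≡⟨ four r ⟩
  4 * r       ≤⟨ *-monoˡ-≤ r (m≤m+n 4 12) ⟩
  16 * r      ∎))
  where
  open ≤-Reasoning
  four : ∀ r → 2 * (2 * r) ≡ 4 * r
  four = solve-∀

lemma11 : (n r q : ℕ) → 3 ≤ n → 2 ≤ r → 1 ≤ q →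
    10 * (n + 1) * (q + 16 * r + 1) * r ≤ 2 ^ (q + 16 * r ∸ 1) →
    (G : SimpleGraph (Vtx n (kOf (q + 16 * r + 1)))) →
    OddCarousel n (q + 16 * r + 1) G →
    (side : Vtx n (kOf (q + 16 * r + 1)) → Bool) →
    (m : ℕ) → HasRank (allVtx n (kOf (q + 16 * r + 1))) (adj G) side (λ v → not (side v)) m →
    m < r →
    Σ ℕ λ t → q ≤ t × t ≤ q + 16 * r ∸ 1 ×
      (X1UnionIn side t false ⊎ X1UnionIn side t true)
lemma11 (suc n) r q _ _ _ _ G carousel side m (_ , rank-bound) m<r =
  conclude (some-or-all (λ i → monochromatic-or-split (λ a → InBlock? (block i) (suc (toℕ a))) c c′))
  where
  k = kOf (q + 16 * r + 1)
  X₁ X₂ : Fin k → Vtx (suc n) k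
  X₁ = part fzero
  X₂ = part (nextIdx fzero)
  c c′ : Fin k → Bool
  c a = side (X₁ a)
  c′ a = side (X₂ (opposite a))
  block : Fin (2 * r) → ℕ
  block i = q + 2 * toℕ i
  InBlockAt : Fin (2 * r) → Fin k → Set
  InBlockAt i a = InBlock (block i) (suc (toℕ a))

  open Split
  open Ladder _≟ⱽ_ (allVtx _ _) (allVtx-unique _ _) allVtx-complete
              G X₁ X₂ (X₁X₂-crossing {s = q + 16 * r + 1} {G} carousel) side rank-bound

  2m<2r : m + m < 2 * r
  2m<2r = subst (m + m <_) (cong (r +_) (sym (+-identityʳ r))) (+-mono-< m<r m<r)

  conclude : (∃ λ i → Monochromatic (InBlockAt i) c) ⊎ (∀ i → Split (InBlockAt i) c c′) →
    Σ ℕ λ t → q ≤ t × t ≤ q + 16 * r ∸ 1 × (X1UnionIn side t false ⊎ X1UnionIn side t true)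
  conclude (inj₁ (i , mono)) =
    block i , m≤m+n q _ , block-in-range q r (toℕ<n i) , monochromatic⇒X1UnionIn {t = block i} mono
  conclude (inj₂ splits) = ⊥-elim (<⇒≱ 2m<2r (ladder-length (λ i → lower (splits i)) (λ i → upper (splits i))
                              (λ i → lower≤upper (splits i)) separated (λ i → colours-split (splits i))))
    where
    separated : ∀ i j → i <ᶠ j → toℕ (upper (splits i)) < toℕ (lower (splits j))
    separated i j i<j = s≤s⁻¹ (InBlock-< {t = block i} (block-gap q i<j) (upper∈ (splits i)) (lower∈ (splits j)))
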